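{- Let $\ell \leq k$ and let $F=F^+ \wedge F^-$ be an $(\ell,k)$-CNF formula, i.e. $F^+$ consists of $\ell$-clauses containing only positive literals and $F^-$ consists of $k$-clauses containing only negative literals. Let $G$ be the $k$-CNFification of $F$, obtained by replacing each clause $C$ of size $k'<k$ by $C \vee \mathcal{K}_{k-k'}$, where $\mathcal{K}_{k-k'}$ is the complete $(k-k')$-CNF formula (all $2^{k-k'}$ clauses) over $k-k'$ fresh variables $y^C_1,\dots,y^C_{k-k'}$, and expanding by distributivity into a $k$-CNF formula. Then (i) $e(G) \leq 4^{k-\ell}|F^+| + 2^{k-\ell}|F^+|\cdot|F^-|$, (ii) $\mathrm{occ}_G(x) \cdot \mathrm{occ}_G(\bar{x}) \leq \max\{4^{k-\ell}, 2^{k-\ell}|F^+|\cdot|F^-|\}$ for every variable $x$.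
   Context: Two clauses conflict if some variable occurs positively in one and negatively in the other; $e(G)$ is the number of conflicting pairs of clauses of $G$. For a literal $u$, $\mathrm{occ}_G(u)$ is the number of clauses of $G$ containing $u$. $|F|$ denotes the number of clauses. -}

module Defs where

open import Data.Nat using (ℕ; zero; suc; _+_)
open import Data.Nat.Properties using () renaming (_≟_ to _≟ℕ_)
open import Data.Product using (_×_; _,_)
open import Data.Product.Properties using () renaming (≡-dec to ×-≡-dec)
open import Data.Sum using (_⊎_; inj₁; inj₂)
open import Data.Sum.Properties using () renaming (≡-dec to ⊎-≡-dec)
open import Data.List using (List; []; _∷_; _++_; map; concatMap; length; filter; upTo)
open import Data.List.Relation.Unary.Any using (Any; any?)
open import Data.List.Membership.DecPropositional using () renaming (_∈?_ to mem?)
open import Relation.Nullary using (Dec; yes; no)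
open import Relation.Binary.PropositionalEquality using (_≡_; refl; cong)
open import Relation.Binary.Definitions using (DecidableEquality)

-- Variables of G: inj₁ x is an original variable x of F,
-- inj₂ (i , j) is the fresh variable y^{C_i}_j for the i-th clause C_i of F⁺.
GVar : Set
GVar = ℕ ⊎ (ℕ × ℕ)

_≟V_ : DecidableEquality GVar
_≟V_ = ⊎-≡-dec _≟ℕ_ (×-≡-dec _≟ℕ_ _≟ℕ_)

data Lit : Set where
  pos : GVar → Lit
  neg : GVar → Lit

_≟L_ : DecidableEquality Lit
pos x ≟L pos y with x ≟V y
... | yes refl = yes refl
... | no ¬p = no λ { refl → ¬p refl }
neg x ≟L neg y with x ≟V y
... | yes refl = yes refl
... | no ¬p = no λ { refl → ¬p refl }
pos x ≟L neg y = no λ ()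
neg x ≟L pos y = no λ ()

~_ : Lit → Lit
~ pos x = neg x
~ neg x = pos x

Clause : Set
Clause = List Lit

CNF : Set
CNF = List Clause

_∈L?_ : (u : Lit) → (C : Clause) → Dec (Data.List.Membership.DecPropositional._∈_ _≟L_ u C)
u ∈L? C = mem? _≟L_ u C

Conflict : Clause → Clause → Set
Conflict C D = Any (λ u → Data.List.Membership.DecPropositional._∈_ _≟L_ (~ u) D) C

conflict? : (C D : Clause) → Dec (Conflict C D)
conflict? C D = any? (λ u → (~ u) ∈L? D) C

-- e(G): number of conflicting (unordered) pairs of clauses, pairs taken
-- over distinct positions of the clause list
e : CNF → ℕ
e [] = 0
e (C ∷ G) = length (filter (conflict? C) G) + e G

occ : CNF → Lit → ℕ
occ G u = length (filter (u ∈L?_) G)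

completeCNF : List GVar → CNF
completeCNF [] = [] ∷ []
completeCNF (v ∷ vs) = concatMap (λ c → (pos v ∷ c) ∷ (neg v ∷ c) ∷ []) (completeCNF vs)

-- C ∨ K expanded by distributivity
orCNF : Clause → CNF → CNF
orCNF C K = map (C ++_) K

fresh : ℕ → ℕ → List GVar
fresh m i = map (λ j → inj₂ (i , j)) (upTo m)

posClause : List ℕ → Clause
posClause xs = map (λ x → pos (inj₁ x)) xs

negClause : List ℕ → Clause
negClause xs = map (λ x → neg (inj₁ x)) xs

cnfPos : ℕ → ℕ → List (List ℕ) → CNF
cnfPos m i [] = []
cnfPos m i (C ∷ Fp) = orCNF (posClause C) (completeCNF (fresh m i)) ++ cnfPos m (suc i) Fp

-- k-CNFification of F = F⁺ ∧ F⁻ where F⁺ has ℓ-clauses and F⁻ has k-clauses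
-- (only the F⁺ clauses have size < k when ℓ < k; when ℓ = k, m = 0 and
-- completeCNF [] = [[]] leaves the clauses unchanged)
kCNFify : ℕ → ℕ → List (List ℕ) → List (List ℕ) → CNF
kCNFify ℓ k Fp Fm = cnfPos (k Data.Nat.∸ ℓ) 0 Fp ++ map negClause Fm

-- G consists of one block Cᵢ ∨ 𝒦 of 2^(k-ℓ) clauses for each clause Cᵢ of F⁺, followed by
-- the clauses of F⁻. Clauses of distinct blocks never conflict: they share only positive
-- original literals, since the fresh variables of different blocks are distinct; and the
-- purely negative clauses of F⁻ do not conflict with each other. So every conflict lies
-- inside a block (at most (2^(k-ℓ))² = 4^(k-ℓ) per block) or between a block and a clause of
-- F⁻ (at most 2^(k-ℓ)|F⁺|·|F⁻|). Likewise a fresh variable occurs only in its own block, so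
-- both of its literals occur at most 2^(k-ℓ) times, while an original variable occurs
-- positively only in the blocks and negatively only in F⁻.
module Submission where

open import Defs
open import Data.Nat using (ℕ; suc; _+_; _*_; _∸_; _^_; _≤_; _⊔_; z≤n)
open import Data.Nat.Properties
open import Data.Nat.Tactic.RingSolver using (solve-∀)
open import Data.Product using (_×_; _,_)
open import Data.Sum using (inj₁; inj₂)
open import Data.Unit using (⊤; tt)
open import Data.Empty using (⊥)
open import Relation.Binary.PropositionalEquality
  using (_≡_; refl; sym; trans; cong; cong₂; module ≡-Reasoning)
open import Relation.Nullary using (¬_; yes; no)
open import Data.List using (List; []; _∷_; _++_; length; map; filter; concatMap; upTo)
open import Data.List.Properties
  using (length-map; length-++; length-upTo; length-filter; filter-++; filter-none)
open import Data.List.Relation.Unary.All as All using (All; []; _∷_)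
open import Data.List.Relation.Unary.All.Properties using (++⁺; map⁺; concat⁺)
open import Data.List.Relation.Unary.Any using (here; there)
open import Data.List.Relation.Unary.Unique.Propositional using (Unique)

Separated : (Lit → Set) → (Lit → Set) → Set
Separated P Q = ∀ u → P u → ¬ Q (~ u)

¬Conflict-separated : ∀ {P Q : Lit → Set} {C D} →
  Separated P Q → All P C → All Q D → ¬ Conflict C D
¬Conflict-separated sep (p ∷ ps) qs (here u∈D) = sep _ p (All.lookup qs u∈D)
¬Conflict-separated sep (p ∷ ps) qs (there c) = ¬Conflict-separated sep ps qs c

crossConflicts : CNF → CNF → ℕ
crossConflicts [] B = 0
crossConflicts (C ∷ A) B = length (filter (conflict? C) B) + crossConflicts A B

e-++ : ∀ A B → e (A ++ B) ≡ e A + crossConflicts A B + e B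
e-++ [] B = refl
e-++ (C ∷ A) B = begin
  length (filter (conflict? C) (A ++ B)) + e (A ++ B)
    ≡⟨ cong₂ _+_ (trans (cong length (filter-++ (conflict? C) A B))
                        (length-++ (filter (conflict? C) A))) (e-++ A B) ⟩
  (x + y) + (e A + crossConflicts A B + e B)
    ≡⟨ interchange x y (e A) (crossConflicts A B) (e B) ⟩
  (x + e A) + (y + crossConflicts A B) + e B ∎
  where
  open ≡-Reasoning
  x = length (filter (conflict? C) A)
  y = length (filter (conflict? C) B)
  interchange : ∀ x y a c b → (x + y) + (a + c + b) ≡ (x + a) + (y + c) + b
  interchange = solve-∀

crossConflicts-≤ : ∀ A B → crossConflicts A B ≤ length A * length B
crossConflicts-≤ [] B = z≤n
crossConflicts-≤ (C ∷ A) B = +-mono-≤ (length-filter (conflict? C) B) (crossConflicts-≤ A B)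

crossConflicts-separated : ∀ {P Q : Lit → Set} → Separated P Q → ∀ A B →
  All (All P) A → All (All Q) B → crossConflicts A B ≡ 0
crossConflicts-separated sep [] B pa qb = refl
crossConflicts-separated sep (C ∷ A) B (pc ∷ pa) qb
  rewrite filter-none (conflict? C) (All.map (¬Conflict-separated sep pc) qb) =
  crossConflicts-separated sep A B pa qb

e-≤-square : ∀ A → e A ≤ length A * length A
e-≤-square [] = z≤n
e-≤-square (C ∷ A) = begin
  length (filter (conflict? C) A) + e A
    ≤⟨ +-mono-≤ (length-filter (conflict? C) A) (e-≤-square A) ⟩
  n + n * n      ≡⟨ sym (*-suc n n) ⟩
  n * suc n      ≤⟨ *-monoˡ-≤ (suc n) (n≤1+n n) ⟩
  suc n * suc n  ∎
  where
  open ≤-Reasoning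
  n = length A

e-separated : ∀ {P : Lit → Set} → Separated P P → ∀ A → All (All P) A → e A ≡ 0
e-separated sep [] pa = refl
e-separated sep (C ∷ A) (pc ∷ pa)
  rewrite filter-none (conflict? C) (All.map (¬Conflict-separated sep pc) pa) =
  e-separated sep A pa

occ-++ : ∀ A B u → occ (A ++ B) u ≡ occ A u + occ B u
occ-++ A B u = trans (cong length (filter-++ (u ∈L?_) A B)) (length-++ (filter (u ∈L?_) A))

occ-≤-length : ∀ A u → occ A u ≤ length A
occ-≤-length A u = length-filter (u ∈L?_) A

occ-absent : ∀ {P : Lit → Set} A u → All (All P) A → ¬ P u → occ A u ≡ 0
occ-absent A u pa ¬pu =
  cong length (filter-none (u ∈L?_) (All.map (λ pc u∈C → ¬pu (All.lookup pc u∈C)) pa))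

occ-++-absentʳ : ∀ {P : Lit → Set} A B u → All (All P) B → ¬ P u → occ (A ++ B) u ≡ occ A u
occ-++-absentʳ A B u pb ¬pu =
  trans (occ-++ A B u) (trans (cong (occ A u +_) (occ-absent B u pb ¬pu)) (+-identityʳ (occ A u)))

occ-++-absentˡ : ∀ {P : Lit → Set} A B u → All (All P) A → ¬ P u → occ (A ++ B) u ≡ occ B u
occ-++-absentˡ A B u pa ¬pu = trans (occ-++ A B u) (cong (_+ occ B u) (occ-absent A u pa ¬pu))

length-concatMap-const : ∀ {A B : Set} {n} (f : A → List B) → (∀ x → length (f x) ≡ n) →
  ∀ xs → length (concatMap f xs) ≡ n * length xs
length-concatMap-const {n = n} f hf [] = sym (*-zeroʳ n)
length-concatMap-const {n = n} f hf (x ∷ xs) = begin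
  length (f x ++ concatMap f xs)          ≡⟨ length-++ (f x) ⟩
  length (f x) + length (concatMap f xs)  ≡⟨ cong₂ _+_ (hf x) (length-concatMap-const f hf xs) ⟩
  n + n * length xs                       ≡⟨ sym (*-suc n (length xs)) ⟩
  n * suc (length xs)                     ∎
  where open ≡-Reasoning

length-completeCNF : ∀ vs → length (completeCNF vs) ≡ 2 ^ length vs
length-completeCNF [] = refl
length-completeCNF (v ∷ vs) =
  trans (length-concatMap-const (λ c → (pos v ∷ c) ∷ (neg v ∷ c) ∷ []) (λ _ → refl)
                                (completeCNF vs))
        (cong (2 *_) (length-completeCNF vs))

All-completeCNF : ∀ {P : Lit → Set} vs →
  All (λ v → P (pos v) × P (neg v)) vs → All (All P) (completeCNF vs)
All-completeCNF [] [] = [] ∷ []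
All-completeCNF (v ∷ vs) ((pv , p¬v) ∷ ps) =
  concat⁺ (map⁺ (All.map (λ pc → (pv ∷ pc) ∷ (p¬v ∷ pc) ∷ []) (All-completeCNF vs ps)))

InBlock : ℕ → Lit → Set
InBlock i (pos (inj₁ _)) = ⊤
InBlock i (neg (inj₁ _)) = ⊥
InBlock i (pos (inj₂ (a , _))) = a ≡ i
InBlock i (neg (inj₂ (a , _))) = a ≡ i

InBlocksFrom : ℕ → Lit → Set
InBlocksFrom i (pos (inj₁ _)) = ⊤
InBlocksFrom i (neg (inj₁ _)) = ⊥
InBlocksFrom i (pos (inj₂ (a , _))) = i ≤ a
InBlocksFrom i (neg (inj₂ (a , _))) = i ≤ a

NegOriginal : Lit → Set
NegOriginal (pos _) = ⊥
NegOriginal (neg (inj₁ _)) = ⊤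
NegOriginal (neg (inj₂ _)) = ⊥

IsFreshOf : ℕ → Lit → Set
IsFreshOf a (pos (inj₂ (b , _))) = b ≡ a
IsFreshOf a (neg (inj₂ (b , _))) = b ≡ a
IsFreshOf a _ = ⊥

InBlock⇒InBlocksFrom : ∀ {i} u → InBlock i u → InBlocksFrom i u
InBlock⇒InBlocksFrom (pos (inj₁ _)) _ = tt
InBlock⇒InBlocksFrom (pos (inj₂ _)) refl = ≤-refl
InBlock⇒InBlocksFrom (neg (inj₂ _)) refl = ≤-refl

InBlocksFrom-suc : ∀ {i} u → InBlocksFrom (suc i) u → InBlocksFrom i u
InBlocksFrom-suc (pos (inj₁ _)) _ = tt
InBlocksFrom-suc (pos (inj₂ _)) i<a = <⇒≤ i<a
InBlocksFrom-suc (neg (inj₂ _)) i<a = <⇒≤ i<a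

InBlock-separated-InBlocksFrom : ∀ i → Separated (InBlock i) (InBlocksFrom (suc i))
InBlock-separated-InBlocksFrom i (pos (inj₂ _)) refl = 1+n≰n
InBlock-separated-InBlocksFrom i (neg (inj₂ _)) refl = 1+n≰n

NegOriginal-separated : Separated NegOriginal NegOriginal
NegOriginal-separated (neg (inj₁ _)) _ ()

InBlock-fresh : ∀ {i a} u → InBlock i u → IsFreshOf a u → a ≡ i
InBlock-fresh (pos (inj₂ _)) refl refl = refl
InBlock-fresh (neg (inj₂ _)) refl refl = refl

InBlocksFrom-fresh : ∀ {i a} u → InBlocksFrom i u → IsFreshOf a u → i ≤ a
InBlocksFrom-fresh (pos (inj₂ _)) i≤a refl = i≤a
InBlocksFrom-fresh (neg (inj₂ _)) i≤a refl = i≤a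

length-fresh : ∀ m i → length (fresh m i) ≡ m
length-fresh m i = trans (length-map _ (upTo m)) (length-upTo m)

block : ℕ → ℕ → List ℕ → CNF
block m i C = orCNF (posClause C) (completeCNF (fresh m i))

length-block : ∀ m i C → length (block m i C) ≡ 2 ^ m
length-block m i C = begin
  length (block m i C)                ≡⟨ length-map (posClause C ++_) (completeCNF (fresh m i)) ⟩
  length (completeCNF (fresh m i))    ≡⟨ length-completeCNF (fresh m i) ⟩
  2 ^ length (fresh m i)              ≡⟨ cong (2 ^_) (length-fresh m i) ⟩
  2 ^ m                               ∎
  where open ≡-Reasoning

All-block : ∀ m i C → All (All (InBlock i)) (block m i C)
All-block m i C =
  map⁺ (All.map (++⁺ (map⁺ (All.universal (λ _ → tt) C)))
                (All-completeCNF (fresh m i) (map⁺ (All.universal (λ _ → refl , refl) _))))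

All-cnfPos : ∀ m i Fp → All (All (InBlocksFrom i)) (cnfPos m i Fp)
All-cnfPos m i [] = []
All-cnfPos m i (C ∷ Fp) =
  ++⁺ (All.map (All.map (λ {u} → InBlock⇒InBlocksFrom u)) (All-block m i C))
      (All.map (All.map (λ {u} → InBlocksFrom-suc u)) (All-cnfPos m (suc i) Fp))

length-cnfPos : ∀ m i Fp → length (cnfPos m i Fp) ≡ 2 ^ m * length Fp
length-cnfPos m i [] = sym (*-zeroʳ (2 ^ m))
length-cnfPos m i (C ∷ Fp) = begin
  length (block m i C ++ cnfPos m (suc i) Fp)
    ≡⟨ length-++ (block m i C) ⟩
  length (block m i C) + length (cnfPos m (suc i) Fp)
    ≡⟨ cong₂ _+_ (length-block m i C) (length-cnfPos m (suc i) Fp) ⟩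
  2 ^ m + 2 ^ m * length Fp
    ≡⟨ sym (*-suc (2 ^ m) (length Fp)) ⟩
  2 ^ m * suc (length Fp) ∎
  where open ≡-Reasoning

2^m*2^m≡4^m : ∀ m → 2 ^ m * 2 ^ m ≡ 4 ^ m
2^m*2^m≡4^m m = begin
  2 ^ m * 2 ^ m  ≡⟨ sym (^-distribˡ-+-* 2 m m) ⟩
  2 ^ (m + m)    ≡⟨ cong (λ n → 2 ^ (m + n)) (sym (+-identityʳ m)) ⟩
  2 ^ (2 * m)    ≡⟨ sym (^-*-assoc 2 2 m) ⟩
  4 ^ m          ∎
  where open ≡-Reasoning

e-block : ∀ m i C → e (block m i C) ≤ 4 ^ m
e-block m i C = ≤-trans (e-≤-square (block m i C))
  (≤-reflexive (trans (cong₂ _*_ (length-block m i C) (length-block m i C)) (2^m*2^m≡4^m m)))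

e-cnfPos : ∀ m i Fp → e (cnfPos m i Fp) ≤ 4 ^ m * length Fp
e-cnfPos m i [] = z≤n
e-cnfPos m i (C ∷ Fp) = begin
  e (B ++ Bs)                          ≡⟨ e-++ B Bs ⟩
  e B + crossConflicts B Bs + e Bs     ≡⟨ cong (λ c → e B + c + e Bs) noCross ⟩
  e B + 0 + e Bs                       ≡⟨ cong (_+ e Bs) (+-identityʳ (e B)) ⟩
  e B + e Bs                           ≤⟨ +-mono-≤ (e-block m i C) (e-cnfPos m (suc i) Fp) ⟩
  4 ^ m + 4 ^ m * length Fp            ≡⟨ sym (*-suc (4 ^ m) (length Fp)) ⟩
  4 ^ m * suc (length Fp)              ∎
  where
  open ≤-Reasoning
  B = block m i C
  Bs = cnfPos m (suc i) Fp
  noCross : crossConflicts B Bs ≡ 0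
  noCross = crossConflicts-separated (InBlock-separated-InBlocksFrom i) B Bs
              (All-block m i C) (All-cnfPos m (suc i) Fp)

occ-cnfPos-fresh : ∀ m {a} u → IsFreshOf a u → ∀ i Fp → occ (cnfPos m i Fp) u ≤ 2 ^ m
occ-cnfPos-fresh m u fu i [] = z≤n
occ-cnfPos-fresh m {a} u fu i (C ∷ Fp) with a ≟ i
... | yes refl = begin
  occ (block m a C ++ cnfPos m (suc a) Fp) u
    ≡⟨ occ-++-absentʳ (block m a C) (cnfPos m (suc a) Fp) u (All-cnfPos m (suc a) Fp)
         (λ p → 1+n≰n (InBlocksFrom-fresh u p fu)) ⟩
  occ (block m a C) u     ≤⟨ occ-≤-length (block m a C) u ⟩
  length (block m a C)    ≡⟨ length-block m a C ⟩
  2 ^ m                   ∎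
  where open ≤-Reasoning
... | no a≢i = ≤-trans
  (≤-reflexive (occ-++-absentˡ (block m i C) (cnfPos m (suc i) Fp) u (All-block m i C)
                 (λ p → a≢i (InBlock-fresh u p fu))))
  (occ-cnfPos-fresh m u fu (suc i) Fp)

All-negClauses : ∀ Fm → All (All NegOriginal) (map negClause Fm)
All-negClauses Fm = map⁺ (All.universal (λ C → map⁺ (All.universal (λ _ → tt) C)) Fm)

module _ (m : ℕ) (Fp Fm : List (List ℕ)) where

  private
    P = cnfPos m 0 Fp
    N = map negClause Fm

    length-P : length P ≡ 2 ^ m * length Fp
    length-P = length-cnfPos m 0 Fp

    length-N : length N ≡ length Fm
    length-N = length-map negClause Fm

  e-cnfification : e (P ++ N) ≤ 4 ^ m * length Fp + 2 ^ m * length Fp * length Fm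
  e-cnfification = begin
    e (P ++ N)                         ≡⟨ e-++ P N ⟩
    e P + crossConflicts P N + e N     ≡⟨ cong (e P + crossConflicts P N +_)
                                            (e-separated NegOriginal-separated N (All-negClauses Fm)) ⟩
    e P + crossConflicts P N + 0       ≡⟨ +-identityʳ _ ⟩
    e P + crossConflicts P N           ≤⟨ +-mono-≤ (e-cnfPos m 0 Fp) (crossConflicts-≤ P N) ⟩
    4 ^ m * length Fp + length P * length N
      ≡⟨ cong (4 ^ m * length Fp +_) (cong₂ _*_ length-P length-N) ⟩
    4 ^ m * length Fp + 2 ^ m * length Fp * length Fm ∎
    where open ≤-Reasoning

  occ-pos-cnfification : ∀ x → occ (P ++ N) (pos x) ≡ occ P (pos x)
  occ-pos-cnfification x = occ-++-absentʳ P N (pos x) (All-negClauses Fm) (λ ())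

  occ-product-cnfification : ∀ x →
    occ (P ++ N) (pos x) * occ (P ++ N) (neg x) ≤ 4 ^ m ⊔ 2 ^ m * length Fp * length Fm
  occ-product-cnfification (inj₁ n) rewrite occ-pos-cnfification (inj₁ n)
    | occ-++-absentˡ P N (neg (inj₁ n)) (All-cnfPos m 0 Fp) (λ ()) =
    ≤-trans (*-mono-≤ (≤-trans (occ-≤-length P (pos (inj₁ n))) (≤-reflexive length-P))
                      (≤-trans (occ-≤-length N (neg (inj₁ n))) (≤-reflexive length-N)))
            (m≤n⊔m (4 ^ m) _)
  occ-product-cnfification (inj₂ (a , j)) rewrite occ-pos-cnfification (inj₂ (a , j))
    | occ-++-absentʳ P N (neg (inj₂ (a , j))) (All-negClauses Fm) (λ ()) =
    ≤-trans (*-mono-≤ (occ-cnfPos-fresh m (pos (inj₂ (a , j))) refl 0 Fp)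
                      (occ-cnfPos-fresh m (neg (inj₂ (a , j))) refl 0 Fp))
            (≤-trans (≤-reflexive (2^m*2^m≡4^m m)) (m≤m⊔n (4 ^ m) _))

proposition1 : (ℓ k : ℕ) → ℓ ≤ k →
    (Fp Fm : List (List ℕ)) →
    All (λ C → length C ≡ ℓ × Unique C) Fp →
    All (λ C → length C ≡ k × Unique C) Fm →
    (e (kCNFify ℓ k Fp Fm) ≤ 4 ^ (k ∸ ℓ) * length Fp + 2 ^ (k ∸ ℓ) * length Fp * length Fm)
    × ((x : GVar) → occ (kCNFify ℓ k Fp Fm) (pos x) * occ (kCNFify ℓ k Fp Fm) (neg x)
         ≤ (4 ^ (k ∸ ℓ)) ⊔ (2 ^ (k ∸ ℓ) * length Fp * length Fm))
proposition1 ℓ k _ Fp Fm _ _ =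
  e-cnfification (k ∸ ℓ) Fp Fm , occ-product-cnfification (k ∸ ℓ) Fp Fm
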